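{- Let $T$ be a tournament, $S\subseteq V(T)$ and $k$ an integer, and let $e\in A(T)$ be an arc contained in at least $k+1$ $S$-triangles of $T$. Then there exists $F\subseteq A(T)$ with $|F|\le k$ such that $T\circledast F$ has no $S$-cycle if and only if there exists $F'\subseteq A(T\circledast e)$ with $|F'|\le k-1$ such that $(T\circledast e)\circledast F'$ has no $S$-cycle.
   Context: A tournament is a directed graph with exactly one arc between every pair of distinct vertices. An $S$-cycle is a directed cycle containing at least one vertex of $S$; an $S$-triangle is an $S$-cycle of length three. $D\circledast F$ is the digraph obtained from $D$ by reversing every arc of $F$; $T\circledast e$ means $T\circledast\{e\}$. -}

module Defs where

open import Data.Nat using (ℕ; _≤_)
open import Data.Fin using (Fin)
open import Data.Fin.Subset using (Subset; _∈_)
open import Data.List using (List; []; _∷_; length)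
open import Data.List.Membership.Propositional renaming (_∈_ to _∈ₗ_)
open import Data.List.Relation.Unary.All using (All)
open import Data.List.Relation.Unary.Any using (Any)
open import Data.List.Relation.Unary.Unique.Propositional using (Unique)
open import Data.Product using (Σ; _×_; _,_; ∃)
open import Data.Sum using (_⊎_)
open import Data.Integer using (ℤ; +_) renaming (_≤_ to _≤ℤ_)
open import Relation.Nullary using (¬_)
open import Relation.Binary.PropositionalEquality using (_≡_; _≢_)
open import Level using (0ℓ)

Digraph : ℕ → Set₁
Digraph n = Fin n → Fin n → Set

record IsTournament {n : ℕ} (T : Digraph n) : Set where
  field
    irreflexive : ∀ i → ¬ T i i
    total       : ∀ i j → i ≢ j → T i j ⊎ T j i
    antisym     : ∀ i j → T i j → ¬ T j i

-- An arc, as an ordered pair (tail , head).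
Arc : ℕ → Set
Arc n = Fin n × Fin n

-- F ⊆ A(D): a finite set of arcs of D (a duplicate-free list, all of whose
-- members are arcs of D); |F| is its length.
IsArcSet : {n : ℕ} → Digraph n → List (Arc n) → Set
IsArcSet D F = Unique F × All (λ a → D (Data.Product.proj₁ a) (Data.Product.proj₂ a)) F

-- D ⊛ F: reverse every arc of F.
_⊛_ : {n : ℕ} → Digraph n → List (Arc n) → Digraph n
(D ⊛ F) i j = (D i j × ¬ ((i , j) ∈ₗ F)) ⊎ (D j i × ((j , i) ∈ₗ F))

_⊛₁_ : {n : ℕ} → Digraph n → Arc n → Digraph n
D ⊛₁ e = D ⊛ (e ∷ [])

-- Walk D s x vs : arcs x → v₁ → … → vₘ → s, where vs = v₁ … vₘ.
ClosedWalk : {n : ℕ} → Digraph n → Fin n → Fin n → List (Fin n) → Set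
ClosedWalk D s x []       = D x s
ClosedWalk D s x (y ∷ ys) = D x y × ClosedWalk D s y ys

IsCycle : {n : ℕ} → Digraph n → Fin n → List (Fin n) → Set
IsCycle D v vs = Unique (v ∷ vs) × (1 ≤ length vs) × ClosedWalk D v v vs

IsSCycle : {n : ℕ} → Subset n → Digraph n → Fin n → List (Fin n) → Set
IsSCycle S D v vs = IsCycle D v vs × Any (_∈ S) (v ∷ vs)

HasSCycle : {n : ℕ} → Subset n → Digraph n → Set
HasSCycle {n} S D = Σ (Fin n) λ v → Σ (List (Fin n)) λ vs → IsSCycle S D v vs

HasSFAS : {n : ℕ} → Digraph n → Subset n → ℤ → Set
HasSFAS {n} D S k =
  Σ (List (Arc n)) λ F → IsArcSet D F × (+ length F ≤ℤ k) × ¬ HasSCycle S (D ⊛ F)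

-- The S-triangle u → v → w → u through the arc e = (u , v), determined by its third vertex w.
IsSTriangleThrough : {n : ℕ} → Digraph n → Subset n → Fin n → Fin n → Fin n → Set
IsSTriangleThrough T S u v w = T u v × T v w × T w u × (u ∈ S ⊎ v ∈ S ⊎ w ∈ S)

-- Every arc of F other than e = (u , v) destroys at most one S-triangle u → v → w → u,
-- namely the one through the apex w of that arc, so a set of at most k reversals that
-- kills all S-cycles must contain e; reversing e first and then F without e gives the
-- same digraph. Conversely, a solution F' for T ⊛ e either contains (v , u), which can
-- then be dropped, or it can be completed by e.
module Submission where

open import Defs
open import Data.Nat using (ℕ)
open import Data.Fin using (Fin)
open import Data.Fin.Subset using (Subset)
open import Data.Fin.Subset using () renaming (_∈_ to _∈ₛ_)
open import Data.List using (List; length)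
open import Data.List.Relation.Unary.All using (All)
open import Data.List.Relation.Unary.Unique.Propositional using (Unique)
open import Data.Integer using (ℤ; +_; _+_; _-_; _≤_)
open import Data.Product using (_,_)
open import Function.Bundles using (_⇔_)

open import Data.Nat as ℕ using (z≤n; s≤s)
import Data.Nat.Properties as ℕ
open import Data.Integer using (_<_; 1ℤ; -1ℤ; +≤+; +<+)
open import Data.Integer.Properties
  using (+-comm; ≤-trans; <⇒≤; ≤-<-trans; <-≤-trans; drop‿+<+;
         i<j⇒i≤pred[j]; i≤pred[j]⇒i<j; i<j⇒suc[i]≤j; suc[i]≤j⇒i<j)
open import Data.Fin.Properties using () renaming (_≟_ to _≟ᶠ_)
open import Data.Product using (_×_; proj₁; uncurry)
open import Data.Product.Properties using (≡-dec)
open import Data.Sum using (_⊎_; inj₁; inj₂)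
open import Data.List using ([]; _∷_; map; filter)
open import Data.List.Properties using (length-filter; filter-notAll; length-map)
open import Data.List.Relation.Unary.All using ([]; _∷_; lookup; lookupAny; tabulate; all?)
open import Data.List.Relation.Unary.All.Properties using (¬All⇒Any¬)
open import Data.List.Relation.Unary.Any using (Any; here; there)
open import Data.List.Relation.Unary.Any.Properties using (singleton⁻)
open import Data.List.Relation.Unary.AllPairs using ([]; _∷_)
import Data.List.Relation.Unary.Unique.Propositional.Properties as Unique
open import Data.List.Relation.Binary.Subset.Propositional using (_⊆_)
open import Data.List.Membership.Propositional using (_∈_; _∉_; lose)
open import Data.List.Membership.Propositional.Properties using (∈-filter⁺; ∈-filter⁻; ∈-map⁺)
import Data.List.Membership.DecPropositional as DecMembership
open import Relation.Nullary using (¬_; yes; no; contradiction)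
open import Relation.Nullary.Decidable using (¬?)
open import Relation.Binary.Definitions using (DecidableEquality)
open import Relation.Binary.PropositionalEquality using (_≡_; _≢_; refl; sym; subst)
open import Function using (_∘_)
open import Function.Bundles using (mk⇔; module Equivalence)

module Without {a} {A : Set a} (_≟_ : DecidableEquality A) where

  _without_ : List A → A → List A
  xs without x = filter (λ y → ¬? (y ≟ x)) xs

  module _ {x y : A} {xs : List A} where

    ∈-without⁺ : y ∈ xs → y ≢ x → y ∈ xs without x
    ∈-without⁺ = ∈-filter⁺ (λ z → ¬? (z ≟ x))

    ∈-without⁻ : y ∈ xs without x → y ∈ xs × y ≢ x
    ∈-without⁻ = ∈-filter⁻ (λ z → ¬? (z ≟ x))

  module _ {x : A} {xs : List A} where

    without-Unique : Unique xs → Unique (xs without x)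
    without-Unique = Unique.filter⁺ (λ z → ¬? (z ≟ x))

    length-without-≤ : length (xs without x) ℕ.≤ length xs
    length-without-≤ = length-filter (λ z → ¬? (z ≟ x)) xs

    length-without-< : x ∈ xs → length (xs without x) ℕ.< length xs
    length-without-< x∈xs = filter-notAll (λ z → ¬? (z ≟ x)) xs (lose x∈xs (λ x≢x → x≢x refl))

  Unique⇒length-mono-⊆ : {xs ys : List A} → Unique xs → xs ⊆ ys → length xs ℕ.≤ length ys
  Unique⇒length-mono-⊆ {[]} _ _ = z≤n
  Unique⇒length-mono-⊆ {x ∷ xs} {ys} (x∉xs ∷ uxs) xs⊆ys =
    ℕ.≤-trans (s≤s (Unique⇒length-mono-⊆ uxs xs⊆ys∖x)) (length-without-< (xs⊆ys (here refl)))
    where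
    xs⊆ys∖x : xs ⊆ ys without x
    xs⊆ys∖x y∈xs = ∈-without⁺ (xs⊆ys (there y∈xs)) (lookup x∉xs y∈xs ∘ sym)

i<j⇔i≤j-1 : {i j : ℤ} → i < j ⇔ i ≤ j - 1ℤ
i<j⇔i≤j-1 {i} {j} = mk⇔ (subst (i ≤_) (+-comm -1ℤ j) ∘ i<j⇒i≤pred[j])
                        (i≤pred[j]⇒i<j ∘ subst (i ≤_) (+-comm j -1ℤ))

i+1≤j⇒i<j : {i j : ℤ} → i + 1ℤ ≤ j → i < j
i+1≤j⇒i<j {i} {j} = suc[i]≤j⇒i<j ∘ subst (_≤ j) (+-comm i 1ℤ)

Oriented : {n : ℕ} → Digraph n → Set
Oriented D = ∀ i j → D i j → ¬ D j i

infix 4 _⊆ᴬ_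

_⊆ᴬ_ : {n : ℕ} → Digraph n → Digraph n → Set
D ⊆ᴬ E = ∀ {i j} → D i j → E i j

module _ {n : ℕ} {D E : Digraph n} (D⊆E : D ⊆ᴬ E) where

  ClosedWalk-mono : ∀ {s x} vs → ClosedWalk D s x vs → ClosedWalk E s x vs
  ClosedWalk-mono []       d         = D⊆E d
  ClosedWalk-mono (y ∷ ys) (d , ds) = D⊆E d , ClosedWalk-mono ys ds

  HasSCycle-mono : (S : Subset n) → HasSCycle S D → HasSCycle S E
  HasSCycle-mono S (x , xs , (distinct , long , walk) , inS) =
    x , xs , (distinct , long , ClosedWalk-mono xs walk) , inS

_≟ᴬ_ : {n : ℕ} → DecidableEquality (Arc n)
_≟ᴬ_ = ≡-dec _≟ᶠ_ _≟ᶠ_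

module _ {n : ℕ} {D : Digraph n} (oriented : Oriented D) (S : Subset n) where

  open DecMembership (_≟ᶠ_ {n}) using (_∈?_)

  arc⇒≢ : ∀ {i j} → D i j → i ≢ j
  arc⇒≢ {i} d refl = oriented i i d d

  STriangle⇒HasSCycle : ∀ {u v w} {F : List (Arc n)} → IsSTriangleThrough D S u v w →
                        (u , v) ∉ F → (v , w) ∉ F → (w , u) ∉ F → HasSCycle S (D ⊛ F)
  STriangle⇒HasSCycle {u} {v} {w} (Duv , Dvw , Dwu , inS) uv∉F vw∉F wu∉F =
    u , v ∷ w ∷ [] ,
    (((arc⇒≢ Duv ∷ (arc⇒≢ Dwu ∘ sym) ∷ []) ∷ (arc⇒≢ Dvw ∷ []) ∷ [] ∷ []) , s≤s z≤n ,
     inj₁ (Duv , uv∉F) , inj₁ (Dvw , vw∉F) , inj₁ (Dwu , wu∉F)) ,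
    anyS inS
    where
    anyS : u ∈ₛ S ⊎ v ∈ₛ S ⊎ w ∈ₛ S → Any (_∈ₛ S) (u ∷ v ∷ w ∷ [])
    anyS (inj₁ u∈S)        = here u∈S
    anyS (inj₂ (inj₁ v∈S)) = there (here v∈S)
    anyS (inj₂ (inj₂ w∈S)) = there (there (here w∈S))

  apex : Fin n → Arc n → Fin n
  apex v (a , b) with a ≟ᶠ v
  ... | yes _ = b
  ... | no  _ = a

  apex-out : ∀ v w → apex v (v , w) ≡ w
  apex-out v w with v ≟ᶠ v
  ... | yes _  = refl
  ... | no v≢v = contradiction refl v≢v

  apex-in : ∀ {v w} u → w ≢ v → apex v (w , u) ≡ w
  apex-in {v} {w} u w≢v with w ≟ᶠ v
  ... | yes w≡v = contradiction w≡v w≢v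
  ... | no  _   = refl

  -- Both arcs v → w and w → u of the triangle through w have apex w.
  STriangle-apex∉⇒HasSCycle : ∀ {u v w} {F : List (Arc n)} → (u , v) ∉ F →
                              IsSTriangleThrough D S u v w → w ∉ map (apex v) F →
                              HasSCycle S (D ⊛ F)
  STriangle-apex∉⇒HasSCycle {u} {v} {w} {F} uv∉F triangle@(_ , Dvw , _ , _) w∉apices =
    STriangle⇒HasSCycle triangle uv∉F
      (w∉apices ∘ subst (_∈ map (apex v) F) (apex-out v w) ∘ ∈-map⁺ (apex v))
      (w∉apices ∘ subst (_∈ map (apex v) F) (apex-in u (arc⇒≢ Dvw ∘ sym)) ∘ ∈-map⁺ (apex v))

  fewer-reversals-than-triangles⇒HasSCycle :
    ∀ {u v} {F : List (Arc n)} {ws : List (Fin n)} → (u , v) ∉ F →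
    Unique ws → All (IsSTriangleThrough D S u v) ws → length F ℕ.< length ws →
    HasSCycle S (D ⊛ F)
  fewer-reversals-than-triangles⇒HasSCycle {u} {v} {F} {ws} uv∉F uws triangles |F|<|ws|
    with all? (_∈? map (apex v) F) ws
  ... | yes covered = contradiction
          (subst (length ws ℕ.≤_) (length-map (apex v) F)
                 (Without.Unique⇒length-mono-⊆ _≟ᶠ_ uws (lookup covered)))
          (ℕ.<⇒≱ |F|<|ws|)
  ... | no uncovered =
    let triangle , w∉apices = lookupAny triangles (¬All⇒Any¬ (_∈? map (apex v) F) ws uncovered)
    in STriangle-apex∉⇒HasSCycle uv∉F triangle w∉apices

module Reverse {n : ℕ} {D : Digraph n} (oriented : Oriented D) {u v : Fin n} (Duv : D u v)
               (S : Subset n) where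

  open Without (_≟ᴬ_ {n})
  open DecMembership (_≟ᴬ_ {n}) using (_∈?_)

  Dᵉ : Digraph n
  Dᵉ = D ⊛₁ (u , v)

  ¬Dᵉuv : ¬ Dᵉ u v
  ¬Dᵉuv (inj₁ (_ , uv∉e)) = uv∉e (here refl)
  ¬Dᵉuv (inj₂ (Dvu , _))  = oriented u v Duv Dvu

  Dᵉvu : Dᵉ v u
  Dᵉvu = inj₂ (Duv , here refl)

  D⇒Dᵉ : ∀ {i j} → D i j → (i , j) ≢ (u , v) → Dᵉ i j
  D⇒Dᵉ Dij ij≢uv = inj₁ (Dij , ij≢uv ∘ singleton⁻)

  Dᵉ⇒D : ∀ {i j} → Dᵉ i j → (i , j) ≢ (v , u) → D i j
  Dᵉ⇒D (inj₁ (Dij , _))         _     = Dij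
  Dᵉ⇒D (inj₂ (_ , here refl))   ij≢vu = contradiction refl ij≢vu

  arc≢vu : ∀ {i j} → D i j → (i , j) ≢ (v , u)
  arc≢vu Dvu refl = oriented u v Duv Dvu

  ⊛-without-⊆ : {F : List (Arc n)} → (u , v) ∈ F → All (uncurry D) F →
                Dᵉ ⊛ (F without (u , v)) ⊆ᴬ D ⊛ F
  ⊛-without-⊆ uv∈F arcs (inj₁ (inj₁ (Dij , ij≢e) , ij∉F∖e)) =
    inj₁ (Dij , λ ij∈F → ij∉F∖e (∈-without⁺ ij∈F (ij≢e ∘ here)))
  ⊛-without-⊆ uv∈F arcs (inj₁ (inj₂ (_ , here refl) , _)) = inj₂ (Duv , uv∈F)
  ⊛-without-⊆ uv∈F arcs (inj₂ (inj₁ (Dji , _) , ji∈F∖e)) =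
    inj₂ (Dji , proj₁ (∈-without⁻ ji∈F∖e))
  ⊛-without-⊆ uv∈F arcs (inj₂ (inj₂ (_ , here refl) , vu∈F∖e)) =
    contradiction (lookup arcs (proj₁ (∈-without⁻ vu∈F∖e))) (oriented u v Duv)

  ⊛-∷-⊆ : {G : List (Arc n)} → (v , u) ∉ G → All (uncurry Dᵉ) G →
          D ⊛ ((u , v) ∷ G) ⊆ᴬ Dᵉ ⊛ G
  ⊛-∷-⊆ vu∉G arcs (inj₁ (Dij , ij∉e∷G))   = inj₁ (D⇒Dᵉ Dij (ij∉e∷G ∘ here) , ij∉e∷G ∘ there)
  ⊛-∷-⊆ vu∉G arcs (inj₂ (_ , here refl))  = inj₁ (Dᵉvu , vu∉G)
  ⊛-∷-⊆ vu∉G arcs (inj₂ (_ , there ji∈G)) = inj₂ (lookup arcs ji∈G , ji∈G)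

  without-⊛-⊆ : {G : List (Arc n)} → (v , u) ∈ G → All (uncurry Dᵉ) G →
                D ⊛ (G without (v , u)) ⊆ᴬ Dᵉ ⊛ G
  without-⊛-⊆ vu∈G arcs {i} {j} (inj₁ (Dij , ij∉G∖vu)) with (i , j) ≟ᴬ (u , v)
  ... | yes refl  = inj₂ (Dᵉvu , vu∈G)
  ... | no ij≢uv  =
    inj₁ (D⇒Dᵉ Dij ij≢uv , λ ij∈G → ij∉G∖vu (∈-without⁺ ij∈G (arc≢vu Dij)))
  without-⊛-⊆ vu∈G arcs (inj₂ (_ , ji∈G∖vu)) =
    let ji∈G = proj₁ (∈-without⁻ ji∈G∖vu) in inj₂ (lookup arcs ji∈G , ji∈G)

  IsArcSet-without-uv : {F : List (Arc n)} → IsArcSet D F → IsArcSet Dᵉ (F without (u , v))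
  IsArcSet-without-uv (uF , arcs) =
    without-Unique uF ,
    tabulate (λ a∈F∖e → let a∈F , a≢e = ∈-without⁻ a∈F∖e in
                        D⇒Dᵉ (lookup arcs a∈F) a≢e)

  IsArcSet-without-vu : {G : List (Arc n)} → IsArcSet Dᵉ G → IsArcSet D (G without (v , u))
  IsArcSet-without-vu (uG , arcs) =
    without-Unique uG ,
    tabulate (λ a∈G∖vu → let a∈G , a≢vu = ∈-without⁻ a∈G∖vu in
                         Dᵉ⇒D (lookup arcs a∈G) a≢vu)

  IsArcSet-∷ : {G : List (Arc n)} → (v , u) ∉ G → IsArcSet Dᵉ G → IsArcSet D ((u , v) ∷ G)
  IsArcSet-∷ vu∉G (uG , arcs) =
    tabulate (λ { uv∈G refl → ¬Dᵉuv (lookup arcs uv∈G) }) ∷ uG ,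
    Duv ∷ tabulate (λ a∈G → Dᵉ⇒D (lookup arcs a∈G) (λ { refl → vu∉G a∈G }))

  HasSFAS⇒HasSFAS-⊛₁ : (k : ℤ) {ws : List (Fin n)} → Unique ws →
                       All (IsSTriangleThrough D S u v) ws → k + + 1 ≤ + length ws →
                       HasSFAS D S k → HasSFAS Dᵉ S (k - + 1)
  HasSFAS⇒HasSFAS-⊛₁ k uws triangles k+1≤|ws| (F , arcSet@(_ , arcs) , |F|≤k , acyclic)
    with (u , v) ∈? F
  ... | no uv∉F = contradiction
          (fewer-reversals-than-triangles⇒HasSCycle oriented S uv∉F uws triangles
             (drop‿+<+ (≤-<-trans |F|≤k (i+1≤j⇒i<j k+1≤|ws|))))
          acyclic
  ... | yes uv∈F =
    F without (u , v) , IsArcSet-without-uv arcSet ,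
    Equivalence.to i<j⇔i≤j-1 (<-≤-trans (+<+ (length-without-< uv∈F)) |F|≤k) ,
    acyclic ∘ HasSCycle-mono (⊛-without-⊆ uv∈F arcs) S

  HasSFAS-⊛₁⇒HasSFAS : (k : ℤ) → HasSFAS Dᵉ S (k - + 1) → HasSFAS D S k
  HasSFAS-⊛₁⇒HasSFAS k (G , arcSet@(_ , arcs) , |G|≤k-1 , acyclic) with (v , u) ∈? G
  ... | no vu∉G =
    (u , v) ∷ G , IsArcSet-∷ vu∉G arcSet ,
    i<j⇒suc[i]≤j (Equivalence.from i<j⇔i≤j-1 |G|≤k-1) ,
    acyclic ∘ HasSCycle-mono (⊛-∷-⊆ vu∉G arcs) S
  ... | yes vu∈G =
    G without (v , u) , IsArcSet-without-vu arcSet ,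
    ≤-trans (+≤+ (length-without-≤ {v , u} {G})) (<⇒≤ (Equivalence.from i<j⇔i≤j-1 |G|≤k-1)) ,
    acyclic ∘ HasSCycle-mono (without-⊛-⊆ vu∈G arcs) S

mainTheorem10 : {n : ℕ} (T : Digraph n) → IsTournament T → (S : Subset n) (k : ℤ)
    (u v : Fin n) → T u v →
    (ws : List (Fin n)) → Unique ws → All (IsSTriangleThrough T S u v) ws →
    k + + 1 ≤ + length ws →
    HasSFAS T S k ⇔ HasSFAS (T ⊛₁ (u , v)) S (k - + 1)
mainTheorem10 T tournament S k u v Tuv ws uws triangles k+1≤|ws| =
  mk⇔ (HasSFAS⇒HasSFAS-⊛₁ k uws triangles k+1≤|ws|) (HasSFAS-⊛₁⇒HasSFAS k)
  where open Reverse (IsTournament.antisym tournament) Tuv S
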